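{- Every connected $3$-regular permutation graph has a Hamiltonian path.
   Context: All graphs are finite and simple. A graph $G$ on $n$ vertices is a permutation graph if there is a labeling $v_1, \ldots, v_n$ of its vertices and a permutation $\pi$ of $\{1,\ldots,n\}$ such that for $i<j$, $v_i$ and $v_j$ are adjacent iff $\pi(i) > \pi(j)$. -}

module Defs where

open import Data.Nat using (ℕ; suc; _<_)
open import Data.Bool using (Bool; true; false)
open import Data.Fin using (Fin; toℕ; inject₁) renaming (suc to fsuc)
open import Data.Fin.Properties using () 
open import Data.List using (List; []; _∷_; filter; length)
open import Data.List using (allFin)
open import Data.Product using (Σ; ∃; _×_; _,_)
open import Data.Empty using (⊥)
open import Relation.Binary.PropositionalEquality using (_≡_)
open import Relation.Nullary using (¬_)
open import Function.Bundles using (_↔_; _⇔_; Inverse)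
import Data.Fin as F

record Graph (n : ℕ) : Set where
  field
    adj   : Fin n → Fin n → Bool
    sym   : ∀ u v → adj u v ≡ adj v u
    irrefl : ∀ v → adj v v ≡ false
open Graph public

Adj : ∀ {n} → Graph n → Fin n → Fin n → Set
Adj G u v = adj G u v ≡ true

degree : ∀ {n} → Graph n → Fin n → ℕ
degree G v = length (filter (λ u → Data.Bool._≟_ (adj G v u) true) (allFin _))
  where import Data.Bool

Regular : ∀ {n} → ℕ → Graph n → Set
Regular k G = ∀ v → degree G v ≡ k

data Walk {n} (G : Graph n) : Fin n → Fin n → Set where
  [] : ∀ {u} → Walk G u u
  _∷_ : ∀ {u w v} → Adj G u w → Walk G w v → Walk G u v

Connected : ∀ {n} → Graph n → Set
Connected {n} G = (0 < n) × (∀ u v → Walk G u v)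

IsPermutationGraph : ∀ {n} → Graph n → Set
IsPermutationGraph {n} G =
  Σ (Fin n ↔ Fin n) λ label → Σ (Fin n ↔ Fin n) λ π →
    ∀ (i j : Fin n) → i F.< j →
      (Adj G (Inverse.to label i) (Inverse.to label j) ⇔ (Inverse.to π j F.< Inverse.to π i))

HasHamiltonianPath : ∀ {n} → Graph n → Set
HasHamiltonianPath {n} G =
  Σ (Fin n ↔ Fin n) λ p →
    ∀ (i : Fin n) (j : Fin n) → suc (toℕ i) ≡ toℕ j →
      Adj G (Inverse.to p i) (Inverse.to p j)

-- Order the vertices by label and let p be the permutation, so that positions i < j are
-- adjacent iff p j < p i. If position i has l larger values before it and r smaller values
-- after it, then counting the values below p i gives p i + l = i + r; in a cubic graph
-- l + r = 3, hence 3 + p i = i + 2r and every edge joins positions at distance at most 5.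
-- So the set of values used by the first k positions is pinned down by the six values
-- k - 3, ..., k + 2, and reading the right degrees r one by one drives a finite automaton on
-- these six bits; connectivity means it never returns to its initial state before the end.
-- The Hamiltonian path visits at step t the position t - 2 + e, where e ∈ {0, ..., 4} is read
-- off the degrees at positions t - 2, ..., t + 2. Whether this rule lands on vertices, steps
-- along edges and avoids repeating a vertex within five steps depends only on nine
-- consecutive degrees, so it is checked exhaustively on the finitely many windows the
-- automaton admits; repetitions further apart are impossible because the path stays within
-- distance 2 of the identity.

module Submission where

open import Data.Bool.Base using (Bool; true; false; T; not; _∧_; _∨_; if_then_else_)
open import Data.Bool.ListAction using (all)
open import Data.Bool.Properties
  using (∧-zeroʳ; ∧-identityʳ; ∧-distribˡ-∨; ∨-identityʳ; ∨-zeroʳ; ∨-comm; T?; T-∧; T-∨; T-not-≡)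
import Data.Bool.Properties as Bool
open import Data.Empty using (⊥; ⊥-elim)
open import Data.Fin using (Fin; toℕ; fromℕ<; punchOut; #_)
import Data.Fin.Base as Fin
open import Data.Fin.Properties
  using (toℕ<n; toℕ-fromℕ<; fromℕ<-toℕ; toℕ-injective; any?; punchOut-injective; injective⇒≤)
import Data.Fin.Properties as Fin
open import Data.List.Base
  using (List; []; _∷_; [_]; filter; length; tabulate; mapMaybe; concatMap; deduplicate; _++_)
open import Data.List.Membership.Propositional using (_∈_)
open import Data.List.Membership.DecPropositional using () renaming (_∈?_ to member?)
open import Data.List.Relation.Unary.All as All using (All; all?)
open import Data.List.Relation.Unary.All.Properties using (all⁺)
open import Data.List.Relation.Unary.Any using (here; there)
open import Data.Maybe.Base using (Maybe; just; nothing; maybe)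
open import Data.Nat.Base
open import Data.Nat.Properties
open import Algebra.Properties.CommutativeSemigroup +-commutativeSemigroup
  using (interchange; xy∙z≈xz∙y; xy∙z≈y∙zx)
open import Data.Nat.Tactic.RingSolver using (solve-∀)
open import Data.Product using (∃-syntax; _×_; _,_; proj₁; proj₂)
open import Data.Sum using (inj₁; inj₂)
open import Data.Unit.Base using (⊤)
open import Data.Vec.Base using (Vec; []; _∷_)
import Data.Vec.Properties as Vec
open import Function.Base using (_∘_)
open import Function.Bundles using (_↔_; _⇔_; Inverse; Injection; Equivalence; mk↔ₛ′)
open import Function.Construct.Composition using (_↔-∘_)
open import Function.Definitions using (Injective)
open import Function.Properties.Inverse using (↔⇒↣)
open import Relation.Binary.Definitions using (DecidableEquality; tri<; tri≈; tri>)
open import Relation.Binary.PropositionalEquality hiding ([_])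
open import Relation.Nullary using (¬_; Dec; yes; no; does)
open import Relation.Nullary.Decidable using (map′; toWitness)
open import Defs hiding (sym)

module BoolReflection where

  T⇒≡true : ∀ {b} → T b → b ≡ true
  T⇒≡true {true} _ = refl

  ¬T⇒≡false : ∀ {b} → ¬ T b → b ≡ false
  ¬T⇒≡false {false} _  = refl
  ¬T⇒≡false {true}  ¬t = ⊥-elim (¬t _)

  <ᵇ-true : ∀ {m n} → m < n → (m <ᵇ n) ≡ true
  <ᵇ-true = T⇒≡true ∘ <⇒<ᵇ

  <ᵇ-false : ∀ {m n} → n ≤ m → (m <ᵇ n) ≡ false
  <ᵇ-false {m} {n} n≤m = ¬T⇒≡false (≤⇒≯ n≤m ∘ <ᵇ⇒< m n)

  ≡ᵇ-refl : ∀ m → (m ≡ᵇ m) ≡ true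
  ≡ᵇ-refl m = T⇒≡true (≡⇒≡ᵇ m m refl)

  ≡ᵇ-false : ∀ {m n} → m ≢ n → (m ≡ᵇ n) ≡ false
  ≡ᵇ-false {m} {n} m≢n = ¬T⇒≡false (m≢n ∘ ≡ᵇ⇒≡ m n)

  <ᵇ-+ˡ : ∀ t x y → (t + x <ᵇ t + y) ≡ (x <ᵇ y)
  <ᵇ-+ˡ zero    x y = refl
  <ᵇ-+ˡ (suc t) x y = <ᵇ-+ˡ t x y

  ≡ᵇ-+ˡ : ∀ t x y → (t + x ≡ᵇ t + y) ≡ (x ≡ᵇ y)
  ≡ᵇ-+ˡ zero    x y = refl
  ≡ᵇ-+ˡ (suc t) x y = ≡ᵇ-+ˡ t x y

open BoolReflection

module Counting where

  indicator : Bool → ℕ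
  indicator true  = 1
  indicator false = 0

  count : ℕ → (ℕ → Bool) → ℕ
  count zero    f = 0
  count (suc k) f = count k f + indicator (f k)

  count-cong : ∀ k {f g : ℕ → Bool} → (∀ {j} → j < k → f j ≡ g j) → count k f ≡ count k g
  count-cong zero    eq = refl
  count-cong (suc k) eq = cong₂ _+_ (count-cong k (eq ∘ m<n⇒m<1+n)) (cong indicator (eq (n<1+n k)))

  count-none : ∀ k {f : ℕ → Bool} → (∀ {j} → j < k → f j ≡ false) → count k f ≡ 0
  count-none zero    none = refl
  count-none (suc k) none rewrite none (n<1+n k) = trans (+-identityʳ _) (count-none k (none ∘ m<n⇒m<1+n))

  count-all : ∀ k {f : ℕ → Bool} → (∀ {j} → j < k → f j ≡ true) → count k f ≡ k
  count-all zero    every = refl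
  count-all (suc k) every rewrite every (n<1+n k) | count-all k (every ∘ m<n⇒m<1+n) = +-comm k 1

  count-+ : ∀ a b (f : ℕ → Bool) → count (a + b) f ≡ count a f + count b (λ j → f (a + j))
  count-+ a zero    f rewrite +-identityʳ a = sym (+-identityʳ _)
  count-+ a (suc b) f rewrite +-suc a b | count-+ a b f = +-assoc (count a f) _ _

  count-∨ : ∀ k {f g : ℕ → Bool} → (∀ {j} → j < k → f j ∧ g j ≡ false) →
            count k (λ j → f j ∨ g j) ≡ count k f + count k g
  count-∨ zero    disjoint = refl
  count-∨ (suc k) {f} {g} disjoint = begin
    count k (λ j → f j ∨ g j) + indicator (f k ∨ g k)
      ≡⟨ cong₂ _+_ (count-∨ k (disjoint ∘ m<n⇒m<1+n)) (indicator-∨ (f k) (g k) (disjoint (n<1+n k))) ⟩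
    (count k f + count k g) + (indicator (f k) + indicator (g k))
      ≡⟨ interchange (count k f) (count k g) _ _ ⟩
    (count k f + indicator (f k)) + (count k g + indicator (g k)) ∎
    where
    open ≡-Reasoning
    indicator-∨ : ∀ a b → a ∧ b ≡ false → indicator (a ∨ b) ≡ indicator a + indicator b
    indicator-∨ true  false _ = refl
    indicator-∨ false b     _ = refl

  count-below : ∀ {i} n (f : ℕ → Bool) → i ≤ n → count n (λ j → (j <ᵇ i) ∧ f j) ≡ count i f
  count-below {i} n f i≤n = begin
    count n g                                  ≡⟨ cong (λ m → count m g) (sym (m+[n∸m]≡n i≤n)) ⟩
    count (i + (n ∸ i)) g                      ≡⟨ count-+ i (n ∸ i) g ⟩
    count i g + count (n ∸ i) (λ j → g (i + j))
      ≡⟨ cong₂ _+_ (count-cong i (λ {j} j<i → cong (_∧ f j) (<ᵇ-true j<i)))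
                   (count-none (n ∸ i) (λ {j} _ → cong (_∧ f (i + j)) (<ᵇ-false (m≤m+n i j)))) ⟩
    count i f + 0                               ≡⟨ +-identityʳ _ ⟩
    count i f ∎
    where
    open ≡-Reasoning
    g = λ j → (j <ᵇ i) ∧ f j

  count-≡ᵇ : ∀ {c} n (f : ℕ → Bool) → c < n → count n (λ v → f v ∧ (c ≡ᵇ v)) ≡ indicator (f c)
  count-≡ᵇ {c} (suc n) f c<1+n with m≤n⇒m<n∨m≡n (s≤s⁻¹ c<1+n)
  ... | inj₁ c<n rewrite count-≡ᵇ n f c<n | ≡ᵇ-false (<⇒≢ c<n) | ∧-zeroʳ (f n) = +-identityʳ _
  ... | inj₂ refl rewrite ≡ᵇ-refl c | ∧-identityʳ (f c) =
    cong (_+ indicator (f c)) (count-none c absent)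
    where
    absent : ∀ {j} → j < c → f j ∧ (c ≡ᵇ j) ≡ false
    absent {j} j<c = trans (cong (f j ∧_) (≡ᵇ-false (<⇒≢ j<c ∘ sym))) (∧-zeroʳ (f j))

  count-<ᵇ : ∀ n {x} → x ≤ n → count n (λ v → v <ᵇ x) ≡ x
  count-<ᵇ n {x} x≤n = begin
    count n (λ v → v <ᵇ x)          ≡⟨ count-cong n (λ {v} _ → sym (∧-identityʳ (v <ᵇ x))) ⟩
    count n (λ v → (v <ᵇ x) ∧ true) ≡⟨ count-below n (λ _ → true) x≤n ⟩
    count x (λ _ → true)            ≡⟨ count-all x (λ _ → refl) ⟩
    x ∎
    where open ≡-Reasoning

  count-support : ∀ N a w {f : ℕ → Bool} → (∀ {u} → u < a → f u ≡ false) →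
                  (∀ {u} → a + w ≤ u → f u ≡ false) → (∀ {u} → N ≤ u → f u ≡ false) →
                  count N f ≡ count w (λ o → f (a + o))
  count-support N a w {f} below above beyond = begin
    count N f                             ≡⟨ sym (vanishing N beyond) ⟩
    count (N + (a + w)) f                 ≡⟨ cong (λ m → count m f) (+-comm N (a + w)) ⟩
    count ((a + w) + N) f                 ≡⟨ vanishing (a + w) above ⟩
    count (a + w) f                       ≡⟨ count-+ a w f ⟩
    count a f + count w (λ o → f (a + o)) ≡⟨ cong (_+ count w (λ o → f (a + o))) (count-none a below) ⟩
    count w (λ o → f (a + o)) ∎
    where
    open ≡-Reasoning
    vanishing : ∀ M {M′} → (∀ {u} → M ≤ u → f u ≡ false) → count (M + M′) f ≡ count M f
    vanishing M {M′} zero-from = begin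
      count (M + M′) f                            ≡⟨ count-+ M M′ f ⟩
      count M f + count M′ (λ o → f (M + o))
        ≡⟨ cong (count M f +_) (count-none M′ (λ {o} _ → zero-from (m≤m+n M o))) ⟩
      count M f + 0                               ≡⟨ +-identityʳ _ ⟩
      count M f ∎

  count-filter : ∀ {A : Set} m (g : Fin m → A) (f : A → Bool) (c : ℕ → Bool) →
                 (∀ i → f (g i) ≡ c (toℕ i)) →
                 length (filter (λ x → f x Bool.≟ true) (tabulate g)) ≡ count m c
  count-filter zero    g f c agree = refl
  count-filter (suc m) g f c agree = begin
    length (filter (λ x → f x Bool.≟ true) (tabulate g))
      ≡⟨ head-counted ⟩
    indicator (f (g Fin.zero)) + length (filter (λ x → f x Bool.≟ true) (tabulate (g ∘ Fin.suc)))
      ≡⟨ cong₂ _+_ (cong indicator (agree Fin.zero))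
                   (count-filter m (g ∘ Fin.suc) f (c ∘ suc) (agree ∘ Fin.suc)) ⟩
    indicator (c 0) + count m (c ∘ suc)
      ≡⟨ sym (count-+ 1 m c) ⟩
    count (suc m) c ∎
    where
    open ≡-Reasoning
    head-counted : length (filter (λ x → f x Bool.≟ true) (tabulate g)) ≡
                   indicator (f (g Fin.zero)) + length (filter (λ x → f x Bool.≟ true) (tabulate (g ∘ Fin.suc)))
    head-counted with f (g Fin.zero)
    ... | true  = refl
    ... | false = refl

open Counting

record IsPermutation (n : ℕ) (p : ℕ → ℕ) : Set where
  field
    bounded    : ∀ {i} → i < n → p i < n
    injective  : ∀ {i j} → i < n → j < n → p i ≡ p j → i ≡ j
    surjective : ∀ {v} → v < n → ∃[ i ] i < n × p i ≡ v

module Image (h : ℕ → ℕ) where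

  image : ℕ → ℕ → Bool
  image zero    v = false
  image (suc k) v = image k v ∨ (h k ≡ᵇ v)

  image-sound : ∀ k {v} → T (image k v) → ∃[ j ] j < k × h j ≡ v
  image-sound (suc k) {v} t with Equivalence.to T-∨ t
  ... | inj₁ old = let j , j<k , hj = image-sound k old in j , m<n⇒m<1+n j<k , hj
  ... | inj₂ new = k , n<1+n k , ≡ᵇ⇒≡ (h k) v new

  image-complete : ∀ {k j} → j < k → T (image k (h j))
  image-complete {suc k} {j} j<1+k with m≤n⇒m<n∨m≡n (s≤s⁻¹ j<1+k)
  ... | inj₁ j<k  = Equivalence.from T-∨ (inj₁ (image-complete j<k))
  ... | inj₂ refl = Equivalence.from T-∨ (inj₂ (≡⇒≡ᵇ (h j) (h j) refl))

  InjectiveBelow : ℕ → Set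
  InjectiveBelow k = ∀ {i j} → i < k → j < k → h i ≡ h j → i ≡ j

  image-fresh : ∀ {k} → InjectiveBelow (suc k) → image k (h k) ≡ false
  image-fresh {k} inj = ¬T⇒≡false λ t →
    let j , j<k , hj = image-sound k t in <⇒≢ j<k (inj (m<n⇒m<1+n j<k) (n<1+n k) hj)

  count-image : ∀ {n} k (f : ℕ → Bool) → InjectiveBelow k → (∀ {j} → j < k → h j < n) →
                count n (λ v → f v ∧ image k v) ≡ count k (f ∘ h)
  count-image {n} zero    f _   _       = count-none n (λ {v} _ → ∧-zeroʳ (f v))
  count-image {n} (suc k) f inj bounded = begin
    count n (λ v → f v ∧ (image k v ∨ (h k ≡ᵇ v)))
      ≡⟨ count-cong n (λ {v} _ → ∧-distribˡ-∨ (f v) (image k v) (h k ≡ᵇ v)) ⟩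
    count n (λ v → (f v ∧ image k v) ∨ (f v ∧ (h k ≡ᵇ v)))
      ≡⟨ count-∨ n (λ {v} _ → disjoint v) ⟩
    count n (λ v → f v ∧ image k v) + count n (λ v → f v ∧ (h k ≡ᵇ v))
      ≡⟨ cong₂ _+_ (count-image k f (λ i<k j<k → inj (m<n⇒m<1+n i<k) (m<n⇒m<1+n j<k))
                                    (bounded ∘ m<n⇒m<1+n))
                   (count-≡ᵇ n f (bounded (n<1+n k))) ⟩
    count k (f ∘ h) + indicator (f (h k)) ∎
    where
    open ≡-Reasoning
    disjoint : ∀ v → (f v ∧ image k v) ∧ (f v ∧ (h k ≡ᵇ v)) ≡ false
    disjoint v with f v | h k ≡ᵇ v in eq
    ... | false | _     = refl
    ... | true  | false = ∧-zeroʳ _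
    ... | true  | true rewrite sym (≡ᵇ⇒≡ (h k) v (subst T (sym eq) _)) =
      trans (∧-identityʳ _) (image-fresh inj)

  count-permute : ∀ {n} → IsPermutation n h → (f : ℕ → Bool) → count n f ≡ count n (f ∘ h)
  count-permute {n} perm f = begin
    count n f
      ≡⟨ count-cong n (λ {v} v<n → sym (trans (cong (f v ∧_) (image-full v<n)) (∧-identityʳ (f v)))) ⟩
    count n (λ v → f v ∧ image n v)   ≡⟨ count-image n f injective bounded ⟩
    count n (f ∘ h) ∎
    where
    open ≡-Reasoning
    open IsPermutation perm
    image-full : ∀ {v} → v < n → image n v ≡ true
    image-full v<n with surjective v<n
    ... | i , i<n , refl = T⇒≡true (image-complete i<n)

module Inversions {n} {p : ℕ → ℕ} (perm : IsPermutation n p) where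

  open IsPermutation perm
  open Image p

  inverted : ℕ → ℕ → Bool
  inverted i j = ((j <ᵇ i) ∧ (p i <ᵇ p j)) ∨ ((i <ᵇ j) ∧ (p j <ᵇ p i))

  inverted-sym : ∀ i j → inverted i j ≡ inverted j i
  inverted-sym i j = ∨-comm ((j <ᵇ i) ∧ (p i <ᵇ p j)) _

  leftInversions rightInversions : ℕ → ℕ
  leftInversions  i = count i (λ j → p i <ᵇ p j)
  rightInversions i = count n (λ j → (i <ᵇ j) ∧ (p j <ᵇ p i))

  private
    before-after-disjoint : ∀ i j (a b : Bool) → ((j <ᵇ i) ∧ a) ∧ ((i <ᵇ j) ∧ b) ≡ false
    before-after-disjoint i j a b with j <ᵇ i in eq
    ... | false = refl
    ... | true rewrite <ᵇ-false (<⇒≤ (<ᵇ⇒< j i (subst T (sym eq) _))) = ∧-zeroʳ _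

  inversion-count : ∀ {i} → i < n → count n (inverted i) ≡ leftInversions i + rightInversions i
  inversion-count {i} i<n = begin
    count n (inverted i)
      ≡⟨ count-∨ n (λ {j} _ → before-after-disjoint i j _ _) ⟩
    count n (λ j → (j <ᵇ i) ∧ (p i <ᵇ p j)) + rightInversions i
      ≡⟨ cong (_+ rightInversions i) (count-below n _ (<⇒≤ i<n)) ⟩
    leftInversions i + rightInversions i ∎
    where open ≡-Reasoning

  displacement : ∀ {i} → i < n → p i + leftInversions i ≡ i + rightInversions i
  displacement {i} i<n = begin
    p i + leftInversions i                                   ≡⟨ cong (_+ leftInversions i) (sym smaller-values) ⟩
    (smaller-before + rightInversions i) + leftInversions i  ≡⟨ xy∙z≈xz∙y smaller-before _ _ ⟩
    (smaller-before + leftInversions i) + rightInversions i  ≡⟨ cong (_+ rightInversions i) before-total ⟩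
    i + rightInversions i ∎
    where
    open ≡-Reasoning
    smaller-before = count i (λ j → p j <ᵇ p i)
    smaller-split : ∀ {j} → j < n →
                    (p j <ᵇ p i) ≡ ((j <ᵇ i) ∧ (p j <ᵇ p i)) ∨ ((i <ᵇ j) ∧ (p j <ᵇ p i))
    smaller-split {j} _ with <-cmp j i
    ... | tri< j<i _ _ rewrite <ᵇ-true j<i | <ᵇ-false (<⇒≤ j<i) = sym (∨-identityʳ _)
    ... | tri≈ _ refl _ rewrite <ᵇ-false (≤-refl {p i}) | <ᵇ-false (≤-refl {i}) = refl
    ... | tri> _ _ i<j rewrite <ᵇ-true i<j | <ᵇ-false (<⇒≤ i<j) = refl
    smaller-values : smaller-before + rightInversions i ≡ p i
    smaller-values = begin
      smaller-before + rightInversions i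
        ≡⟨ cong (_+ rightInversions i) (sym (count-below n _ (<⇒≤ i<n))) ⟩
      count n (λ j → (j <ᵇ i) ∧ (p j <ᵇ p i)) + rightInversions i
        ≡⟨ sym (count-∨ n (λ {j} _ → before-after-disjoint i j _ _)) ⟩
      count n (λ j → ((j <ᵇ i) ∧ (p j <ᵇ p i)) ∨ ((i <ᵇ j) ∧ (p j <ᵇ p i)))
        ≡⟨ sym (count-cong n smaller-split) ⟩
      count n (λ j → p j <ᵇ p i)      ≡⟨ sym (count-permute perm (_<ᵇ p i)) ⟩
      count n (λ v → v <ᵇ p i)        ≡⟨ count-<ᵇ n (<⇒≤ (bounded i<n)) ⟩
      p i ∎
    before-total : smaller-before + leftInversions i ≡ i
    before-total = begin
      smaller-before + leftInversions i                      ≡⟨ sym (count-∨ i (λ {j} j<i → exclusive j<i)) ⟩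
      count i (λ j → (p j <ᵇ p i) ∨ (p i <ᵇ p j))              ≡⟨ count-all i total ⟩
      i ∎
      where
      exclusive : ∀ {j} → j < i → (p j <ᵇ p i) ∧ (p i <ᵇ p j) ≡ false
      exclusive {j} _ with p j <ᵇ p i in eq
      ... | false = refl
      ... | true = <ᵇ-false (<⇒≤ (<ᵇ⇒< (p j) (p i) (subst T (sym eq) _)))
      total : ∀ {j} → j < i → (p j <ᵇ p i) ∨ (p i <ᵇ p j) ≡ true
      total {j} j<i with <-cmp (p j) (p i)
      ... | tri< lt _ _ rewrite <ᵇ-true lt = refl
      ... | tri≈ _ eq _ = ⊥-elim (<⇒≢ j<i (injective (<-trans j<i i<n) i<n eq))
      ... | tri> _ _ gt rewrite <ᵇ-true gt = ∨-zeroʳ _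

Indecomposable : ℕ → (ℕ → ℕ) → Set
Indecomposable n p = ∀ {k} → 0 < k → k < n → ¬ (∀ {i j} → i < k → k ≤ j → j < n → p i < p j)

record HamiltonianSequence (n : ℕ) (adjacent : ℕ → ℕ → Bool) : Set where
  field
    visit           : ℕ → ℕ
    visit-<         : ∀ {t} → t < n → visit t < n
    visit-injective : ∀ {s t} → s < n → t < n → visit s ≡ visit t → s ≡ t
    visit-adjacent  : ∀ {t} → suc t < n → T (adjacent (visit t) (visit (suc t)))

module Automaton where

  Bits : Set
  Bits = Vec Bool 6

  bit : ∀ {m} → Vec Bool m → ℕ → Bool
  bit []       _       = false
  bit (b ∷ _)  zero    = b
  bit (_ ∷ bs) (suc o) = bit bs o

  sample : ∀ m → (ℕ → Bool) → Vec Bool m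
  sample zero    f = []
  sample (suc m) f = f 0 ∷ sample m (f ∘ suc)

  bit-sample : ∀ m (f : ℕ → Bool) {o} → o < m → bit (sample m f) o ≡ f o
  bit-sample (suc m) f {zero}  _   = refl
  bit-sample (suc m) f {suc o} o<m = bit-sample m (f ∘ suc) (s≤s⁻¹ o<m)

  bit-beyond : ∀ {m} (bs : Vec Bool m) {o} → m ≤ o → bit bs o ≡ false
  bit-beyond []       _          = refl
  bit-beyond (_ ∷ bs) (s≤s m≤o) = bit-beyond bs m≤o

  sample-cong : ∀ m {f g : ℕ → Bool} → (∀ {o} → o < m → f o ≡ g o) → sample m f ≡ sample m g
  sample-cong zero    eq = refl
  sample-cong (suc m) eq = cong₂ _∷_ (eq z<s) (sample-cong m (eq ∘ s<s))

  settled : Bits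
  settled = sample 6 (_<ᵇ 3)

  largerBefore : Bits → ℕ → ℕ
  largerBefore b r = count 6 (λ o → (2 * r <ᵇ o) ∧ bit b o)

  -- The next position takes value k - 3 + 2r: it needs 3 - r larger values before it, the
  -- value must be free, and value k - 3 must be used by then.
  admissible : Bits → ℕ → Bool
  admissible b r = (largerBefore b r ≡ᵇ 3 ∸ r) ∧ not (bit b (2 * r)) ∧ (bit b 0 ∨ (r ≡ᵇ 0))

  next : Bits → ℕ → Bits
  next b r = sample 6 (λ o → bit b (suc o) ∨ (2 * r ≡ᵇ suc o))

  data Phase : Set where
    before : Phase
    inside : Bits → Phase
    after  : Phase

  data Letter : Set where
    pad : Letter
    deg : ℕ → Letter

  _≟ᴮ_ : DecidableEquality Bits
  _≟ᴮ_ = Vec.≡-dec Bool._≟_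

  _≟ᴾ_ : DecidableEquality Phase
  before   ≟ᴾ before   = yes refl
  inside a ≟ᴾ inside b = map′ (cong inside) (λ { refl → refl }) (a ≟ᴮ b)
  after    ≟ᴾ after    = yes refl
  before   ≟ᴾ inside _ = no λ ()
  before   ≟ᴾ after    = no λ ()
  inside _ ≟ᴾ before   = no λ ()
  inside _ ≟ᴾ after    = no λ ()
  after    ≟ᴾ before   = no λ ()
  after    ≟ᴾ inside _ = no λ ()

  enter : Bits → Phase
  enter b = if does (b ≟ᴮ settled) then after else inside b

  enter-unsettled : ∀ {b} → b ≢ settled → enter b ≡ inside b
  enter-unsettled {b} b≢settled with b ≟ᴮ settled
  ... | yes b≡settled = ⊥-elim (b≢settled b≡settled)
  ... | no _          = refl

  advance : Bits → ℕ → Maybe Phase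
  advance b r = if admissible b r then just (enter (next b r)) else nothing

  advance-admissible : ∀ b r → T (admissible b r) → advance b r ≡ just (enter (next b r))
  advance-admissible b r ok with admissible b r
  ... | true = refl

  step : Phase → Letter → Maybe Phase
  step before     pad     = just before
  step before     (deg r) = advance settled r
  step (inside b) (deg r) = advance b r
  step after      pad     = just after
  step _          _       = nothing

  alphabet : List Letter
  alphabet = pad ∷ deg 0 ∷ deg 1 ∷ deg 2 ∷ deg 3 ∷ []

  explore : ℕ → List Phase → List Phase
  explore zero    seen = seen
  explore (suc k) seen =
    explore k (deduplicate _≟ᴾ_ (seen ++ concatMap (λ s → mapMaybe (step s) alphabet) seen))

  -- Ten rounds reach the fixed point; closedness is verified below rather than assumed.
  reachable : List Phase
  reachable = explore 10 [ before ]

  Successor : Phase → Letter → Set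
  Successor s c = maybe (_∈ reachable) ⊤ (step s c)

  successor? : ∀ s c → Dec (Successor s c)
  successor? s c with step s c
  ... | just s′ = member? _≟ᴾ_ s′ reachable
  ... | nothing = yes _

  reachable-closed : All (λ s → All (Successor s) alphabet) reachable
  reachable-closed = toWitness {a? = all? (λ s → all? (successor? s) alphabet) reachable} _

  deg∈alphabet : ∀ {r} → r ≤ 3 → deg r ∈ alphabet
  deg∈alphabet {0} _ = there (here refl)
  deg∈alphabet {1} _ = there (there (here refl))
  deg∈alphabet {2} _ = there (there (there (here refl)))
  deg∈alphabet {3} _ = there (there (there (there (here refl))))
  deg∈alphabet {suc (suc (suc (suc _)))} (s≤s (s≤s (s≤s ())))

open Automaton

module Windows where

  rank : Letter → ℕ
  rank pad     = 0
  rank (deg r) = r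

  isDeg : Letter → Bool
  isDeg pad     = false
  isDeg (deg _) = true

  -- Found by a computer search; reachable-windows-ok verifies it.
  offset : Letter → Letter → Letter → Letter → Letter → Fin 5
  offset pad (deg 3) (deg 2) (deg 3) (deg 0) = # 4
  offset pad (deg 3) (deg 3) (deg 1) (deg 0) = # 3
  offset pad (deg 3) (deg 3) (deg 3) (deg 0) = # 4
  offset (deg 1) (deg 0) (deg 3) (deg 0) (deg 3) = # 3
  offset (deg 1) (deg 0) (deg 3) (deg 2) (deg 0) = # 4
  offset (deg 1) (deg 0) (deg 3) (deg 3) (deg 0) = # 4
  offset (deg 0) (deg 0) (deg 3) (deg 0) (deg 3) = # 3
  offset (deg 0) (deg 0) (deg 3) (deg 2) (deg 0) = # 4
  offset (deg 0) (deg 0) (deg 3) (deg 3) (deg 0) = # 4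
  offset (deg 0) (deg 3) (deg 1) (deg 0) (deg 3) = # 3
  offset (deg 0) (deg 3) (deg 0) (deg 0) (deg 3) = # 3
  offset (deg 0) (deg 3) (deg 0) (deg 3) (deg 1) = # 1
  offset (deg 0) (deg 3) (deg 0) (deg 3) (deg 2) = # 1
  offset (deg 0) (deg 3) (deg 0) (deg 3) (deg 3) = # 1
  offset (deg 0) (deg 3) (deg 2) (deg 0) (deg 0) = # 1
  offset (deg 0) (deg 3) (deg 2) (deg 0) (deg 3) = # 1
  offset (deg 0) (deg 3) (deg 3) (deg 0) (deg 1) = # 1
  offset (deg 0) (deg 3) (deg 3) (deg 0) (deg 0) = # 1
  offset (deg 0) (deg 3) (deg 3) (deg 0) (deg 3) = # 1
  offset (deg 2) (deg 0) (deg 3) (deg 0) (deg 3) = # 3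
  offset (deg 2) (deg 3) (deg 0) (deg 0) (deg 3) = # 3
  offset (deg 3) (deg 1) (deg 0) (deg 3) (deg 0) = # 0
  offset (deg 3) (deg 1) (deg 0) (deg 3) (deg 2) = # 0
  offset (deg 3) (deg 1) (deg 0) (deg 3) (deg 3) = # 0
  offset (deg 3) (deg 0) (deg 1) (deg 0) pad = # 0
  offset (deg 3) (deg 0) (deg 0) (deg 0) pad = # 0
  offset (deg 3) (deg 0) (deg 0) (deg 3) (deg 0) = # 0
  offset (deg 3) (deg 0) (deg 0) (deg 3) (deg 2) = # 0
  offset (deg 3) (deg 0) (deg 0) (deg 3) (deg 3) = # 0
  offset (deg 3) (deg 0) (deg 3) (deg 1) (deg 0) = # 3
  offset (deg 3) (deg 0) (deg 3) (deg 0) (deg 0) = # 0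
  offset (deg 3) (deg 0) (deg 3) (deg 2) (deg 0) = # 4
  offset (deg 3) (deg 0) (deg 3) (deg 3) (deg 0) = # 4
  offset (deg 3) (deg 2) (deg 0) (deg 0) pad = # 1
  offset (deg 3) (deg 2) (deg 0) (deg 3) (deg 0) = # 1
  offset (deg 3) (deg 2) (deg 3) (deg 0) (deg 0) = # 1
  offset (deg 3) (deg 3) (deg 1) (deg 0) (deg 3) = # 3
  offset (deg 3) (deg 3) (deg 0) (deg 1) (deg 0) = # 3
  offset (deg 3) (deg 3) (deg 0) (deg 0) (deg 0) = # 3
  offset (deg 3) (deg 3) (deg 0) (deg 0) (deg 3) = # 3
  offset (deg 3) (deg 3) (deg 0) (deg 3) (deg 0) = # 4
  offset (deg 3) (deg 3) (deg 3) (deg 0) (deg 0) = # 1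
  offset _ _ _ _ _ = # 2

  offset-cong : ∀ {a b c d e a′ b′ c′ d′ e′} → a ≡ a′ → b ≡ b′ → c ≡ c′ → d ≡ d′ → e ≡ e′ →
                offset a b c d e ≡ offset a′ b′ c′ d′ e′
  offset-cong refl refl refl refl refl = refl

  windowOffset : (ℕ → Letter) → ℕ → ℕ
  windowOffset w d = toℕ (offset (w d) (w (d + 1)) (w (d + 2)) (w (d + 3)) (w (d + 4)))

  -- A window w holds the letters at positions t - 2, ..., t + 6, and at step t + d the path
  -- visits the position at window index d + windowOffset w d. Since 3 + p i = i + 2 r i, letters
  -- at window indices a < b stand for adjacent positions iff key w b < key w a.
  key : (ℕ → Letter) → ℕ → ℕ
  key w a = a + 2 * rank (w a)

  linked : (ℕ → Letter) → ℕ → ℕ → Bool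
  linked w a b = ((b <ᵇ a) ∧ (key w a <ᵇ key w b)) ∨ ((a <ᵇ b) ∧ (key w b <ᵇ key w a))

  visitsVertex : (ℕ → Letter) → Bool
  visitsVertex w = if isDeg (w 2) then isDeg (w (windowOffset w 0)) else true

  followsEdge : (ℕ → Letter) → Bool
  followsEdge w =
    if isDeg (w 2) ∧ isDeg (w 3) then linked w (windowOffset w 0) (1 + windowOffset w 1) else true

  avoidsRepeat : (ℕ → Letter) → ℕ → Bool
  avoidsRepeat w d =
    if isDeg (w 2) ∧ isDeg (w (2 + d)) then not (windowOffset w 0 ≡ᵇ d + windowOffset w d) else true

  pathRule-ok : (ℕ → Letter) → Bool
  pathRule-ok w = visitsVertex w ∧ followsEdge w ∧ all (avoidsRepeat w) (1 ∷ 2 ∷ 3 ∷ 4 ∷ [])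

  if-T : ∀ {b x} → T b → T (if b then x else true) → T x
  if-T {true} _ holds = holds

  module PathRule {w : ℕ → Letter} (ok : T (pathRule-ok w)) (centre : T (isDeg (w 2))) where

    private
      parts = Equivalence.to (T-∧ {visitsVertex w}) ok
      rest  = Equivalence.to (T-∧ {followsEdge w}) (proj₂ parts)

    lands : T (isDeg (w (windowOffset w 0)))
    lands = if-T centre (proj₁ parts)

    links : T (isDeg (w 3)) → T (linked w (windowOffset w 0) (1 + windowOffset w 1))
    links next = if-T (Equivalence.from T-∧ (centre , next)) (proj₁ rest)

    separates : ∀ {d} → 1 ≤ d → d ≤ 4 → T (isDeg (w (2 + d))) → windowOffset w 0 ≢ d + windowOffset w d
    separates {d} 1≤d d≤4 later same = subst T differs (≡⇒≡ᵇ _ _ same)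
      where
      d∈ : ∀ {d} → 1 ≤ d → d ≤ 4 → d ∈ 1 ∷ 2 ∷ 3 ∷ 4 ∷ []
      d∈ {0} () _
      d∈ {1} _ _ = here refl
      d∈ {2} _ _ = there (here refl)
      d∈ {3} _ _ = there (there (here refl))
      d∈ {4} _ _ = there (there (there (here refl)))
      d∈ {suc (suc (suc (suc (suc _))))} _ (s≤s (s≤s (s≤s (s≤s ()))))
      differs : (windowOffset w 0 ≡ᵇ d + windowOffset w d) ≡ false
      differs = Equivalence.to T-not-≡
        (if-T (Equivalence.from T-∧ (centre , later))
              (All.lookup (all⁺ (avoidsRepeat w) _ (proj₂ rest)) (d∈ 1≤d d≤4)))

  _◂_ : Letter → (ℕ → Letter) → ℕ → Letter
  (c ◂ w) zero    = c
  (c ◂ w) (suc j) = w j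

  allWindows : ℕ → Phase → ((ℕ → Letter) → Bool) → Bool
  allWindows zero    s P = P (λ _ → pad)
  allWindows (suc W) s P = all (λ c → maybe (λ s′ → allWindows W s′ (P ∘ (c ◂_))) true (step s c)) alphabet

  reachable-windows-ok : All (λ s → T (allWindows 9 s pathRule-ok)) reachable
  reachable-windows-ok = toWitness {a? = all? (λ s → T? (allWindows 9 s pathRule-ok)) reachable} _

  module Run (ℓ : ℕ → Letter) (φ : ℕ → Phase)
             (runs : ∀ m → step (φ m) (ℓ m) ≡ just (φ (suc m)))
             (spelled : ∀ m → ℓ m ∈ alphabet) where

    window : ℕ → ℕ → ℕ → Letter
    window zero    m = λ _ → pad
    window (suc W) m = ℓ m ◂ window W (suc m)

    window-at : ∀ W m {j} → j < W → window W m j ≡ ℓ (m + j)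
    window-at (suc W) m {zero}  _   = cong ℓ (sym (+-identityʳ m))
    window-at (suc W) m {suc j} j<W = trans (window-at W (suc m) (s≤s⁻¹ j<W)) (cong ℓ (sym (+-suc m j)))

    phase-reachable : φ 0 ≡ before → ∀ m → φ m ∈ reachable
    phase-reachable start zero    = subst (_∈ reachable) (sym start) (here refl)
    phase-reachable start (suc m) =
      subst (maybe (_∈ reachable) ⊤) (runs m)
            (All.lookup (All.lookup reachable-closed (phase-reachable start m)) (spelled m))

    allWindows-sound : ∀ W m P → T (allWindows W (φ m) P) → T (P (window W m))
    allWindows-sound zero    m P ok = ok
    allWindows-sound (suc W) m P ok =
      allWindows-sound W (suc m) (P ∘ (ℓ m ◂_))
        (subst (T ∘ maybe (λ s′ → allWindows W s′ (P ∘ (ℓ m ◂_))) true) (runs m)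
               (All.lookup (all⁺ (λ c → maybe (λ s′ → allWindows W s′ (P ∘ (c ◂_))) true (step (φ m) c))
                                 alphabet ok)
                           (spelled m)))

    window-ok : φ 0 ≡ before → ∀ m → T (pathRule-ok (window 9 m))
    window-ok start m =
      allWindows-sound 9 m pathRule-ok (All.lookup reachable-windows-ok (phase-reachable start m))

open Windows

module CubicPermutation {n} {p : ℕ → ℕ} (perm : IsPermutation n p)
  (cubic : ∀ {i} → i < n → count n (Inversions.inverted perm i) ≡ 3)
  (indecomposable : Indecomposable n p) (nonempty : 0 < n) where

  open IsPermutation perm
  open Image p
  open Inversions perm

  r : ℕ → ℕ
  r = rightInversions

  private
    left+right≡3 : ∀ {i} → i < n → leftInversions i + r i ≡ 3
    left+right≡3 i<n = trans (sym (inversion-count i<n)) (cubic i<n)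

    injective-below : ∀ {k} → k ≤ n → InjectiveBelow k
    injective-below k≤n i<k j<k = injective (<-≤-trans i<k k≤n) (<-≤-trans j<k k≤n)

  r≤3 : ∀ {i} → i < n → r i ≤ 3
  r≤3 {i} i<n = subst (r i ≤_) (left+right≡3 i<n) (m≤n+m (r i) _)

  value-identity : ∀ {i} → i < n → 3 + p i ≡ i + 2 * r i
  value-identity {i} i<n = begin
    3 + p i                               ≡⟨ cong (_+ p i) (sym (left+right≡3 i<n)) ⟩
    (leftInversions i + r i) + p i        ≡⟨ xy∙z≈y∙zx (leftInversions i) (r i) (p i) ⟩
    r i + (p i + leftInversions i)        ≡⟨ cong (r i +_) (displacement i<n) ⟩
    r i + (i + r i)                       ≡⟨ double (r i) i ⟩
    i + 2 * r i ∎
    where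
    open ≡-Reasoning
    double : ∀ a b → a + (b + a) ≡ b + 2 * a
    double = solve-∀

  value-near : ∀ {i} → i < n → i ≤ 3 + p i × 3 + p i ≤ i + 6
  value-near {i} i<n =
    subst (i ≤_) (sym (value-identity i<n)) (m≤m+n i _) ,
    subst (_≤ i + 6) (sym (value-identity i<n)) (+-monoʳ-≤ i (*-monoʳ-≤ 2 (r≤3 i<n)))

  -- Shifted by 3: taken k u says that the value u - 3 is used by a position below k; the
  -- negative values u < 3 count as used.
  taken : ℕ → ℕ → Bool
  taken k u = (u <ᵇ 3) ∨ image k (u ∸ 3)

  taken-suc : ∀ k u → taken (suc k) u ≡ taken k u ∨ (3 + p k ≡ᵇ u)
  taken-suc k 0                     = refl
  taken-suc k 1                     = refl
  taken-suc k 2                     = refl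
  taken-suc k (suc (suc (suc _)))   = refl

  taken-image : ∀ {k u} → T (taken k u) → 3 ≤ u → ∃[ j ] j < k × 3 + p j ≡ u
  taken-image {u = 0} _ ()
  taken-image {u = 1} _ (s≤s ())
  taken-image {u = 2} _ (s≤s (s≤s ()))
  taken-image {k} {suc (suc (suc v))} t _ = let j , j<k , pj≡v = image-sound k t in j , j<k , cong (3 +_) pj≡v

  taken-all : ∀ {u} → u < 3 + n → T (taken n u)
  taken-all {0} _ = _
  taken-all {1} _ = _
  taken-all {2} _ = _
  taken-all {suc (suc (suc v))} v<n with surjective (s≤s⁻¹ (s≤s⁻¹ (s≤s⁻¹ v<n)))
  ... | j , j<n , refl = image-complete j<n

  taken-below : ∀ {k u} → u < k → u < 3 + n → T (taken k u)
  taken-below {u = 0} _ _ = _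
  taken-below {u = 1} _ _ = _
  taken-below {u = 2} _ _ = _
  taken-below {u = suc (suc (suc v))} u<k v<n with surjective (s≤s⁻¹ (s≤s⁻¹ (s≤s⁻¹ v<n)))
  ... | j , j<n , refl = image-complete (≤-<-trans (proj₁ (value-near j<n)) u<k)

  taken-above : ∀ {k u} → k ≤ n → k + 6 ≤ u → taken k u ≡ false
  taken-above {k} {u} k≤n k+6≤u = ¬T⇒≡false λ t →
    let j , j<k , 3+pj≡u = taken-image t (≤-trans (≤-trans (m≤m+n 3 3) (m≤n+m 6 k)) k+6≤u)
        3+pj<u = ≤-<-trans (proj₂ (value-near (<-≤-trans j<k k≤n))) (<-≤-trans (+-monoˡ-< 6 j<k) k+6≤u)
    in <-irrefl refl (subst (_< u) 3+pj≡u 3+pj<u)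

  taken-beyond : ∀ {k u} → k ≤ n → 3 + n ≤ u → taken k u ≡ false
  taken-beyond {k} {u} k≤n 3+n≤u = ¬T⇒≡false λ t →
    let j , j<k , 3+pj≡u = taken-image t (≤-trans (m≤m+n 3 n) 3+n≤u)
    in <⇒≱ (bounded (<-≤-trans j<k k≤n)) (+-cancelˡ-≤ 3 n (p j) (subst (3 + n ≤_) (sym 3+pj≡u) 3+n≤u))

  -- Values below k - 3 are all used and values from k + 3 on all free (taken-below,
  -- taken-above), so these six bits are the whole state.
  state : ℕ → Bits
  state k = sample 6 (λ o → taken k (k + o))

  state-bit : ∀ k {o} → o < 6 → bit (state k) o ≡ taken k (k + o)
  state-bit k = bit-sample 6 (λ o → taken k (k + o))

  state-initial : state 0 ≡ settled
  state-initial = sample-cong 6 (λ {o} _ → ∨-identityʳ (o <ᵇ 3))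

  state-final : state n ≡ settled
  state-final = sample-cong 6 λ {o} _ → by-size (o <? 3)
    where
    by-size : ∀ {o} → Dec (o < 3) → taken n (n + o) ≡ (o <ᵇ 3)
    by-size {o} (yes o<3) =
      trans (T⇒≡true (taken-all (subst (n + o <_) (+-comm n 3) (+-monoʳ-< n o<3)))) (sym (<ᵇ-true o<3))
    by-size {o} (no o≮3)  =
      trans (taken-beyond ≤-refl (subst (_≤ n + o) (+-comm n 3) (+-monoʳ-≤ n (≮⇒≥ o≮3)))) (sym (<ᵇ-false (≮⇒≥ o≮3)))

  state-next : ∀ {k} → k < n → next (state k) (r k) ≡ state (suc k)
  state-next {k} k<n = sample-cong 6 λ {o} o<6 → begin
    bit (state k) (suc o) ∨ (2 * r k ≡ᵇ suc o)      ≡⟨ cong₂ _∨_ (shifted o<6) (sym (arrival o)) ⟩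
    taken k (suc k + o) ∨ (3 + p k ≡ᵇ suc k + o)     ≡⟨ sym (taken-suc k (suc k + o)) ⟩
    taken (suc k) (suc k + o) ∎
    where
    open ≡-Reasoning
    arrival : ∀ o → (3 + p k ≡ᵇ suc k + o) ≡ (2 * r k ≡ᵇ suc o)
    arrival o = trans (cong₂ _≡ᵇ_ (value-identity k<n) (sym (+-suc k o))) (≡ᵇ-+ˡ k _ _)
    shifted : ∀ {o} → o < 6 → bit (state k) (suc o) ≡ taken k (suc k + o)
    shifted {o} o<6 with m≤n⇒m<n∨m≡n (s≤s⁻¹ o<6)
    ... | inj₁ o<5  = trans (state-bit k (s≤s o<5)) (cong (taken k) (+-suc k o))
    ... | inj₂ refl = trans (bit-beyond (state k) ≤-refl) (sym (taken-above (<⇒≤ k<n) (≤-reflexive (+-suc k 5))))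

  leftInversions-state : ∀ {k} → k < n → leftInversions k ≡ largerBefore (state k) (r k)
  leftInversions-state {k} k<n = begin
    leftInversions k
      ≡⟨ sym (count-image k (p k <ᵇ_) (injective-below (<⇒≤ k<n)) (bounded ∘ λ j<k → <-trans j<k k<n)) ⟩
    count n (λ v → (p k <ᵇ v) ∧ image k v)       ≡⟨ sym (count-+ 3 n later) ⟩
    count (3 + n) later                          ≡⟨ count-support (3 + n) k 6 below above beyond ⟩
    count 6 (λ o → later (k + o))
      ≡⟨ count-cong 6 (λ {o} o<6 → cong₂ _∧_ (relative o) (sym (state-bit k o<6))) ⟩
    largerBefore (state k) (r k) ∎
    where
    open ≡-Reasoning
    later : ℕ → Bool
    later u = (3 + p k <ᵇ u) ∧ taken k u
    below : ∀ {u} → u < k → later u ≡ false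
    below {u} u<k = cong (_∧ taken k u) (<ᵇ-false (≤-trans (<⇒≤ u<k) (proj₁ (value-near k<n))))
    above : ∀ {u} → k + 6 ≤ u → later u ≡ false
    above {u} k+6≤u = trans (cong ((3 + p k <ᵇ u) ∧_) (taken-above (<⇒≤ k<n) k+6≤u)) (∧-zeroʳ _)
    beyond : ∀ {u} → 3 + n ≤ u → later u ≡ false
    beyond {u} 3+n≤u = trans (cong ((3 + p k <ᵇ u) ∧_) (taken-beyond (<⇒≤ k<n) 3+n≤u)) (∧-zeroʳ _)
    relative : ∀ o → (3 + p k <ᵇ k + o) ≡ (2 * r k <ᵇ o)
    relative o = trans (cong (_<ᵇ k + o) (value-identity k<n)) (<ᵇ-+ˡ k _ _)

  state-admissible : ∀ {k} → k < n → T (admissible (state k) (r k))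
  state-admissible {k} k<n = Equivalence.from T-∧ (balanced , Equivalence.from T-∧ (fresh , filled))
    where
    balanced : T (largerBefore (state k) (r k) ≡ᵇ 3 ∸ r k)
    balanced = ≡⇒≡ᵇ _ _ (begin
      largerBefore (state k) (r k)        ≡⟨ sym (leftInversions-state k<n) ⟩
      leftInversions k                    ≡⟨ sym (m+n∸n≡m _ (r k)) ⟩
      leftInversions k + r k ∸ r k        ≡⟨ cong (_∸ r k) (left+right≡3 k<n) ⟩
      3 ∸ r k ∎)
      where open ≡-Reasoning
    unused-value : bit (state k) (2 * r k) ≡ false
    unused-value with 2 * r k <? 6
    ... | yes 2r<6 = begin
      bit (state k) (2 * r k)   ≡⟨ state-bit k 2r<6 ⟩
      taken k (k + 2 * r k)     ≡⟨ cong (taken k) (sym (value-identity k<n)) ⟩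
      image k (p k)             ≡⟨ image-fresh (injective-below k<n) ⟩
      false ∎
      where open ≡-Reasoning
    ... | no 2r≮6 = bit-beyond (state k) (≮⇒≥ 2r≮6)
    fresh : T (not (bit (state k) (2 * r k)))
    fresh = Equivalence.from T-not-≡ unused-value
    filled : T (bit (state k) 0 ∨ (r k ≡ᵇ 0))
    filled with Equivalence.to T-∨ (subst T (taken-suc k k) (taken-below (n<1+n k) (<-≤-trans k<n (m≤n+m n 3))))
    ... | inj₁ old =
      Equivalence.from T-∨ (inj₁ (subst T (sym (trans (state-bit k z<s) (cong (taken k) (+-identityʳ k)))) old))
    ... | inj₂ new = Equivalence.from T-∨ (inj₂ (≡⇒≡ᵇ (r k) 0 (halve (+-cancelˡ-≡ k _ 0 stays))))
      where
      stays : k + 2 * r k ≡ k + 0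
      stays = trans (sym (value-identity k<n)) (trans (≡ᵇ⇒≡ _ _ new) (sym (+-identityʳ k)))
      halve : ∀ {x} → 2 * x ≡ 0 → x ≡ 0
      halve {zero} _ = refl

  state-unsettled : ∀ {k} → 0 < k → k < n → state k ≢ settled
  state-unsettled {k} 0<k k<n settled-k =
    indecomposable 0<k k<n (λ i<k k≤j j<n → <-≤-trans (stays-below i<k) (stays-above k≤j j<n))
    where
    frontier : ∀ {u} → k ≤ u → u < k + 6 → taken k u ≡ (u ∸ k <ᵇ 3)
    frontier {u} k≤u u<k+6 = begin
      taken k u                  ≡⟨ cong (taken k) (sym (m+[n∸m]≡n k≤u)) ⟩
      taken k (k + (u ∸ k))      ≡⟨ sym (state-bit k o<6) ⟩
      bit (state k) (u ∸ k)      ≡⟨ cong (λ b → bit b (u ∸ k)) settled-k ⟩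
      bit settled (u ∸ k)        ≡⟨ bit-sample 6 (_<ᵇ 3) o<6 ⟩
      (u ∸ k <ᵇ 3) ∎
      where
      open ≡-Reasoning
      o<6 = m<n+o⇒m∸n<o u k u<k+6
    stays-below : ∀ {i} → i < k → p i < k
    stays-below {i} i<k with p i <? k
    ... | yes pi<k = pi<k
    ... | no pi≮k  = ⊥-elim (subst T (trans (frontier k≤u u<k+6) (<ᵇ-false 3≤u∸k)) (image-complete i<k))
      where
      k≤u : k ≤ 3 + p i
      k≤u = ≤-trans (≮⇒≥ pi≮k) (m≤n+m (p i) 3)
      u<k+6 : 3 + p i < k + 6
      u<k+6 = ≤-<-trans (proj₂ (value-near (<-trans i<k k<n))) (+-monoˡ-< 6 i<k)
      3≤u∸k : 3 ≤ 3 + p i ∸ k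
      3≤u∸k = m+n≤o⇒m≤o∸n 3 (+-monoʳ-≤ 3 (≮⇒≥ pi≮k))
    stays-above : ∀ {j} → k ≤ j → j < n → k ≤ p j
    stays-above {j} k≤j j<n with p j <? k
    ... | no pj≮k  = ≮⇒≥ pj≮k
    ... | yes pj<k =
      let j′ , j′<k , pj′≡pj = image-sound k present
      in ⊥-elim (<⇒≱ j′<k (subst (k ≤_) (sym (injective (<-trans j′<k k<n) j<n pj′≡pj)) k≤j))
      where
      u<k+3 : 3 + p j < k + 3
      u<k+3 = subst (3 + p j <_) (+-comm 3 k) (+-monoʳ-< 3 pj<k)
      present : T (image k (p j))
      present with 3 + p j <? k
      ... | yes u<k = taken-below u<k (+-monoʳ-< 3 (bounded j<n))
      ... | no u≮k  = subst T (sym (trans (frontier (≮⇒≥ u≮k) (<-≤-trans u<k+3 (+-monoʳ-≤ k (m≤m+n 3 3))))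
                                          (<ᵇ-true (m<n+o⇒m∸n<o (3 + p j) k u<k+3)))) _

  -- Two padding letters first, so that the window of position t starts at letter index t.
  letter : ℕ → Letter
  letter 0             = pad
  letter 1             = pad
  letter (suc (suc t)) = if t <ᵇ n then deg (r t) else pad

  phaseAt : ℕ → Phase
  phaseAt zero    = before
  phaseAt (suc t) = if suc t <ᵇ n then inside (state (suc t)) else after

  phase : ℕ → Phase
  phase 0             = before
  phase 1             = before
  phase (suc (suc t)) = phaseAt t

  letter-inside : ∀ {t} → t < n → letter (2 + t) ≡ deg (r t)
  letter-inside t<n rewrite <ᵇ-true t<n = refl

  letter-outside : ∀ {t} → n ≤ t → letter (2 + t) ≡ pad
  letter-outside n≤t rewrite <ᵇ-false n≤t = refl

  phaseAt-outside : ∀ {t} → n ≤ t → phaseAt t ≡ after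
  phaseAt-outside {zero}  n≤0   = ⊥-elim (<⇒≱ nonempty n≤0)
  phaseAt-outside {suc t} n≤1+t rewrite <ᵇ-false n≤1+t = refl

  step-inside : ∀ {t} → t < n → ∀ x → step (phaseAt t) (deg x) ≡ advance (state t) x
  step-inside {zero}  _     x rewrite state-initial = refl
  step-inside {suc t} 1+t<n x rewrite <ᵇ-true 1+t<n = refl

  enter-state : ∀ {t} → t < n → enter (state (suc t)) ≡ phaseAt (suc t)
  enter-state {t} t<n with m≤n⇒m<n∨m≡n t<n
  ... | inj₁ 1+t<n rewrite <ᵇ-true 1+t<n = enter-unsettled (state-unsettled z<s 1+t<n)
  enter-state {t} t<n | inj₂ 1+t≡n rewrite <ᵇ-false (≤-reflexive (sym 1+t≡n)) =
    cong enter (trans (cong state 1+t≡n) state-final)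

  runs : ∀ m → step (phase m) (letter m) ≡ just (phase (suc m))
  runs 0             = refl
  runs 1             = refl
  runs (suc (suc t)) with t <? n
  ... | yes t<n = begin
    step (phaseAt t) (letter (2 + t))        ≡⟨ cong (step (phaseAt t)) (letter-inside t<n) ⟩
    step (phaseAt t) (deg (r t))             ≡⟨ step-inside t<n (r t) ⟩
    advance (state t) (r t)                  ≡⟨ advance-admissible (state t) (r t) (state-admissible t<n) ⟩
    just (enter (next (state t) (r t)))      ≡⟨ cong (just ∘ enter) (state-next t<n) ⟩
    just (enter (state (suc t)))             ≡⟨ cong just (enter-state t<n) ⟩
    just (phaseAt (suc t)) ∎
    where open ≡-Reasoning
  ... | no t≮n rewrite letter-outside (≮⇒≥ t≮n) | phaseAt-outside (≮⇒≥ t≮n)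
                     | phaseAt-outside (m≤n⇒m≤1+n (≮⇒≥ t≮n)) = refl

  spelled : ∀ m → letter m ∈ alphabet
  spelled 0 = here refl
  spelled 1 = here refl
  spelled (suc (suc t)) with t <? n
  ... | yes t<n = subst (_∈ alphabet) (sym (letter-inside t<n)) (deg∈alphabet (r≤3 t<n))
  ... | no t≮n  = subst (_∈ alphabet) (sym (letter-outside (≮⇒≥ t≮n))) (here refl)

  open Run letter phase runs spelled

  offsetAt : ℕ → ℕ
  offsetAt m = toℕ (offset (letter m) (letter (m + 1)) (letter (m + 2)) (letter (m + 3)) (letter (m + 4)))

  offsetAt≤4 : ∀ m → offsetAt m ≤ 4
  offsetAt≤4 m = s≤s⁻¹ (toℕ<n _)

  offset-in-window : ∀ m {d} → d ≤ 4 → d + offsetAt m < 9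
  offset-in-window m d≤4 = s≤s (+-mono-≤ d≤4 (offsetAt≤4 m))

  windowOffset-window : ∀ t {d} → d ≤ 4 → windowOffset (window 9 t) d ≡ offsetAt (t + d)
  windowOffset-window t {d} d≤4 =
    cong toℕ (offset-cong (window-at 9 t (s≤s (≤-trans d≤4 (m≤m+n 4 4))))
                          (at 1 (≤ᵇ⇒≤ 1 4 _)) (at 2 (≤ᵇ⇒≤ 2 4 _)) (at 3 (≤ᵇ⇒≤ 3 4 _)) (at 4 ≤-refl))
    where
    at : ∀ i → i ≤ 4 → window 9 t (d + i) ≡ letter (t + d + i)
    at i i≤4 = trans (window-at 9 t (s≤s (+-mono-≤ d≤4 i≤4))) (cong letter (sym (+-assoc t d i)))

  window-real : ∀ t {d} → t + d < n → d ≤ 6 → window 9 t (2 + d) ≡ deg (r (t + d))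
  window-real t {d} t+d<n d≤6 = begin
    window 9 t (2 + d)      ≡⟨ window-at 9 t (s≤s (s≤s (s≤s d≤6))) ⟩
    letter (t + (2 + d))    ≡⟨ cong letter (reorder t d) ⟩
    letter (2 + (t + d))    ≡⟨ letter-inside t+d<n ⟩
    deg (r (t + d)) ∎
    where
    open ≡-Reasoning
    reorder : ∀ t d → t + (2 + d) ≡ 2 + (t + d)
    reorder = solve-∀

  isDeg-window : ∀ t {d} → t + d < n → d ≤ 6 → T (isDeg (window 9 t (2 + d)))
  isDeg-window t t+d<n d≤6 = subst (T ∘ isDeg) (sym (window-real t t+d<n d≤6)) _

  letter-position : ∀ m → T (isDeg (letter m)) → ∃[ P ] m ≡ 2 + P × P < n
  letter-position (suc (suc t)) real with t <? n
  ... | yes t<n = t , refl , t<n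
  ... | no t≮n  = ⊥-elim (subst (T ∘ isDeg) (letter-outside (≮⇒≥ t≮n)) real)

  module Rule t (t<n : t < n) =
    PathRule {window 9 t} (window-ok refl t) (isDeg-window t (subst (_< n) (sym (+-identityʳ t)) t<n) z≤n)

  windowOffset-window₀ : ∀ t → windowOffset (window 9 t) 0 ≡ offsetAt t
  windowOffset-window₀ t = trans (windowOffset-window t z≤n) (cong offsetAt (+-identityʳ t))

  route : ℕ → ℕ
  route t = t + offsetAt t ∸ 2

  lands : ∀ {t} → t < n → T (isDeg (letter (t + offsetAt t)))
  lands {t} t<n = subst (λ c → T (isDeg c)) landing (Rule.lands t t<n)
    where
    landing : window 9 t (windowOffset (window 9 t) 0) ≡ letter (t + offsetAt t)
    landing = trans (cong (window 9 t) (windowOffset-window₀ t)) (window-at 9 t (offset-in-window t z≤n))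

  route-spec : ∀ {t} → t < n → t + offsetAt t ≡ 2 + route t × route t < n
  route-spec {t} t<n =
    let P , t+offsetAt≡2+P , P<n = letter-position (t + offsetAt t) (lands t<n)
        route≡P : route t ≡ P
        route≡P = cong (_∸ 2) t+offsetAt≡2+P
    in trans t+offsetAt≡2+P (cong (2 +_) (sym route≡P)) , subst (_< n) (sym route≡P) P<n

  linked-inverted : ∀ t {a b Pa Pb} → a < 9 → b < 9 → t + a ≡ 2 + Pa → Pa < n → t + b ≡ 2 + Pb → Pb < n →
                    linked (window 9 t) a b ≡ inverted Pa Pb
  linked-inverted t a<9 b<9 ea Pa<n eb Pb<n =
    cong₂ _∨_ (cong₂ _∧_ (order eb ea) (order (scaled a<9 ea Pa<n) (scaled b<9 eb Pb<n)))
              (cong₂ _∧_ (order ea eb) (order (scaled b<9 eb Pb<n) (scaled a<9 ea Pa<n)))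
    where
    order : ∀ {x y X Y} → t + x ≡ X → t + y ≡ Y → (x <ᵇ y) ≡ (X <ᵇ Y)
    order refl refl = sym (<ᵇ-+ˡ t _ _)
    scaled : ∀ {a P} → a < 9 → t + a ≡ 2 + P → P < n → t + key (window 9 t) a ≡ 5 + p P
    scaled {a} {P} a<9 e P<n = begin
      t + (a + 2 * rank (window 9 t a))
        ≡⟨ cong (λ c → t + (a + 2 * rank c))
                (trans (window-at 9 t a<9) (trans (cong letter e) (letter-inside P<n))) ⟩
      t + (a + 2 * r P)      ≡⟨ sym (+-assoc t a _) ⟩
      (t + a) + 2 * r P      ≡⟨ cong (_+ 2 * r P) e ⟩
      2 + (P + 2 * r P)      ≡⟨ cong (2 +_) (sym (value-identity P<n)) ⟩
      5 + p P ∎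
      where open ≡-Reasoning

  route-adjacent : ∀ {t} → suc t < n → T (inverted (route t) (route (suc t)))
  route-adjacent {t} 1+t<n = subst T linked≡inverted (Rule.links t t<n (isDeg-window t t+1<n (s≤s z≤n)))
    where
    t<n = <-trans (n<1+n t) 1+t<n
    t+1<n = subst (_< n) (+-comm 1 t) 1+t<n
    second : windowOffset (window 9 t) 1 ≡ offsetAt (suc t)
    second = trans (windowOffset-window t (s≤s z≤n)) (cong offsetAt (+-comm t 1))
    linked≡inverted : linked (window 9 t) (windowOffset (window 9 t) 0) (1 + windowOffset (window 9 t) 1)
                    ≡ inverted (route t) (route (suc t))
    linked≡inverted = begin
      linked (window 9 t) (windowOffset (window 9 t) 0) (1 + windowOffset (window 9 t) 1)
        ≡⟨ cong₂ (linked (window 9 t)) (windowOffset-window₀ t) (cong suc second) ⟩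
      linked (window 9 t) (offsetAt t) (1 + offsetAt (suc t))
        ≡⟨ linked-inverted t (offset-in-window t z≤n) (offset-in-window (suc t) (s≤s z≤n))
                           (proj₁ (route-spec t<n)) (proj₂ (route-spec t<n))
                           (trans (+-suc t _) (proj₁ (route-spec 1+t<n))) (proj₂ (route-spec 1+t<n)) ⟩
      inverted (route t) (route (suc t)) ∎
      where open ≡-Reasoning

  route-near : ∀ {t d} → 1 ≤ d → d ≤ 4 → t + d < n → route t ≢ route (t + d)
  route-near {t} {d} 1≤d d≤4 t+d<n same =
    Rule.separates t t<n 1≤d d≤4 (isDeg-window t t+d<n (≤-trans d≤4 (m≤m+n 4 2))) offsets-collide
    where
    open ≡-Reasoning
    t<n = ≤-<-trans (m≤m+n t d) t+d<n
    offsets-collide : windowOffset (window 9 t) 0 ≡ d + windowOffset (window 9 t) d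
    offsets-collide = begin
      windowOffset (window 9 t) 0            ≡⟨ windowOffset-window₀ t ⟩
      offsetAt t                         ≡⟨ +-cancelˡ-≡ t _ _ (begin
        t + offsetAt t                      ≡⟨ proj₁ (route-spec t<n) ⟩
        2 + route t                    ≡⟨ cong (2 +_) same ⟩
        2 + route (t + d)              ≡⟨ sym (proj₁ (route-spec t+d<n)) ⟩
        t + d + offsetAt (t + d)            ≡⟨ +-assoc t d _ ⟩
        t + (d + offsetAt (t + d)) ∎) ⟩
      d + offsetAt (t + d)               ≡⟨ cong (d +_) (sym (windowOffset-window t d≤4)) ⟩
      d + windowOffset (window 9 t) d ∎

  route-far : ∀ {t t′} → t + 5 ≤ t′ → t′ < n → route t < route t′
  route-far {t} {t′} t+5≤t′ t′<n = +-cancelˡ-< 2 _ _ (begin-strict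
    2 + route t      ≡⟨ sym (proj₁ (route-spec t<n)) ⟩
    t + offsetAt t        ≤⟨ +-monoʳ-≤ t (offsetAt≤4 t) ⟩
    t + 4              <⟨ +-monoʳ-< t (n<1+n 4) ⟩
    t + 5              ≤⟨ t+5≤t′ ⟩
    t′                 ≤⟨ m≤m+n t′ _ ⟩
    t′ + offsetAt t′      ≡⟨ proj₁ (route-spec t′<n) ⟩
    2 + route t′ ∎)
    where
    open ≤-Reasoning
    t<n = ≤-<-trans (≤-trans (m≤m+n t 5) t+5≤t′) t′<n

  route-apart : ∀ {s t} → s < t → t < n → route s ≢ route t
  route-apart {s} {t} s<t t<n with s + 5 ≤? t
  ... | yes far = <⇒≢ (route-far far t<n)
  ... | no near = route-near (m<n⇒0<n∸m s<t) (s≤s⁻¹ (m<n+o⇒m∸n<o t s (≰⇒> near)))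
                               (subst (_< n) (sym s+d≡t) t<n) ∘ subst (λ x → route s ≡ route x) (sym s+d≡t)
    where
    s+d≡t : s + (t ∸ s) ≡ t
    s+d≡t = m+[n∸m]≡n (<⇒≤ s<t)

  route-injective : ∀ {s t} → s < n → t < n → route s ≡ route t → s ≡ t
  route-injective {s} {t} s<n t<n same with <-cmp s t
  ... | tri< s<t _ _ = ⊥-elim (route-apart s<t t<n same)
  ... | tri≈ _ s≡t _ = s≡t
  ... | tri> _ _ t<s = ⊥-elim (route-apart t<s s<n (sym same))

  hamiltonian : HamiltonianSequence n inverted
  hamiltonian = record
    { visit           = route
    ; visit-<         = proj₂ ∘ route-spec
    ; visit-injective = route-injective
    ; visit-adjacent  = route-adjacent
    }

injective⇒surjective : ∀ {m} {f : Fin m → Fin m} → Injective _≡_ _≡_ f → ∀ y → ∃[ x ] f x ≡ y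
injective⇒surjective {suc m} {f} f-injective y with any? (λ x → f x Fin.≟ y)
... | yes found = found
... | no missed  = ⊥-elim (<-irrefl refl (injective⇒≤ squeeze-injective))
  where
  avoids : ∀ x → y ≢ f x
  avoids x y≡fx = missed (x , sym y≡fx)
  squeeze : Fin (suc m) → Fin m
  squeeze x = punchOut (avoids x)
  squeeze-injective : Injective _≡_ _≡_ squeeze
  squeeze-injective {a} {b} same = f-injective (punchOut-injective (avoids a) (avoids b) same)

injective⇒↔ : ∀ {m} {f : Fin m → Fin m} → Injective _≡_ _≡_ f → Fin m ↔ Fin m
injective⇒↔ {f = f} f-injective =
  mk↔ₛ′ f (proj₁ ∘ hit) (proj₂ ∘ hit) (λ x → f-injective (proj₂ (hit (f x))))
  where hit = injective⇒surjective f-injective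

module Positions (n′ : ℕ) where

  position : ℕ → Fin (suc n′)
  position j with j <? suc n′
  ... | yes j<n = fromℕ< j<n
  ... | no _    = Fin.zero

  toℕ-position : ∀ {j} → j < suc n′ → toℕ (position j) ≡ j
  toℕ-position {j} j<n with j <? suc n′
  ... | yes j<n′ = toℕ-fromℕ< j<n′
  ... | no j≮n   = ⊥-elim (j≮n j<n)

  position-toℕ : ∀ i → position (toℕ i) ≡ i
  position-toℕ i with toℕ i <? suc n′
  ... | yes i<n = fromℕ<-toℕ i i<n
  ... | no i≮n  = ⊥-elim (i≮n (toℕ<n i))

  relabel : Fin (suc n′) ↔ Fin (suc n′) → ℕ → ℕ
  relabel f j = toℕ (Inverse.to f (position j))

  relabel-permutation : ∀ f → IsPermutation (suc n′) (relabel f)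
  relabel-permutation f = record
    { bounded    = λ _ → toℕ<n _
    ; injective  = λ {i} {j} i<n j<n same → begin
        i                  ≡⟨ sym (toℕ-position i<n) ⟩
        toℕ (position i)   ≡⟨ cong toℕ (Injection.injective (↔⇒↣ f) (toℕ-injective same)) ⟩
        toℕ (position j)   ≡⟨ toℕ-position j<n ⟩
        j ∎
    ; surjective = λ {v} v<n → toℕ (Inverse.from f (position v)) , toℕ<n _ , (begin
        relabel f (toℕ (Inverse.from f (position v)))
          ≡⟨ cong (toℕ ∘ Inverse.to f) (position-toℕ _) ⟩
        toℕ (Inverse.to f (Inverse.from f (position v)))
          ≡⟨ cong toℕ (Inverse.strictlyInverseˡ f _) ⟩
        toℕ (position v)   ≡⟨ toℕ-position v<n ⟩
        v ∎)
    }
    where open ≡-Reasoning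

module PermutationGraph {n′} (G : Graph (suc n′)) (label π : Fin (suc n′) ↔ Fin (suc n′))
  (represents : ∀ i j → i Fin.< j →
                Adj G (Inverse.to label i) (Inverse.to label j) ⇔ (Inverse.to π j Fin.< Inverse.to π i))
  where

  open Positions n′

  vertex : ℕ → Fin (suc n′)
  vertex i = Inverse.to label (position i)

  perm : IsPermutation (suc n′) (relabel π)
  perm = relabel-permutation π

  open Inversions perm

  inverted-forward : ∀ {i j} → i < j → inverted i j ≡ (relabel π j <ᵇ relabel π i)
  inverted-forward i<j rewrite <ᵇ-false (<⇒≤ i<j) | <ᵇ-true i<j = refl

  adjacent-forward : ∀ {i j} → i < j → j < suc n′ → adj G (vertex i) (vertex j) ≡ inverted i j
  adjacent-forward {i} {j} i<j j<n =
    trans (reflects (represents (position i) (position j) ordered)) (sym (inverted-forward i<j))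
    where
    ordered : position i Fin.< position j
    ordered = subst₂ _<_ (sym (toℕ-position (<-trans i<j j<n))) (sym (toℕ-position j<n)) i<j
    reflects : ∀ {a m k} → (a ≡ true ⇔ m < k) → a ≡ (m <ᵇ k)
    reflects {false} {m} {k} a⇔ = sym (¬T⇒≡false (λ t → subst T (sym (Equivalence.from a⇔ (<ᵇ⇒< m k t))) _))
    reflects {true}  a⇔ = sym (T⇒≡true (<⇒<ᵇ (Equivalence.to a⇔ refl)))

  adjacent-inverted : ∀ {i j} → i < suc n′ → j < suc n′ → adj G (vertex i) (vertex j) ≡ inverted i j
  adjacent-inverted {i} {j} i<n j<n with <-cmp i j
  ... | tri< i<j _ _ = adjacent-forward i<j j<n
  ... | tri≈ _ refl _ rewrite <ᵇ-false (≤-refl {i}) = Graph.irrefl G (vertex i)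
  ... | tri> _ _ j<i = trans (Graph.sym G _ _) (trans (adjacent-forward j<i i<n) (inverted-sym j i))

  degree-vertex : ∀ {i} → i < suc n′ → degree G (vertex i) ≡ count (suc n′) (inverted i)
  degree-vertex {i} i<n = begin
    degree G (vertex i)
      ≡⟨ count-filter (suc n′) (λ u → u) (adj G (vertex i)) (adj G (vertex i) ∘ position)
                      (λ u → cong (adj G (vertex i)) (sym (position-toℕ u))) ⟩
    count (suc n′) (adj G (vertex i) ∘ position)
      ≡⟨ Image.count-permute (relabel label) (relabel-permutation label) _ ⟩
    count (suc n′) (λ j → adj G (vertex i) (position (relabel label j)))
      ≡⟨ count-cong (suc n′) (λ _ → cong (adj G (vertex i)) (position-toℕ _)) ⟩
    count (suc n′) (λ j → adj G (vertex i) (vertex j))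
      ≡⟨ count-cong (suc n′) (adjacent-inverted i<n) ⟩
    count (suc n′) (inverted i) ∎
    where open ≡-Reasoning

  indecomposable : Connected G → Indecomposable (suc n′) (relabel π)
  indecomposable (_ , walk) {k} 0<k k<n split = crossing (walk (vertex 0) (vertex n′)) first-side last-side
    where
    open ≡-Reasoning
    index : Fin (suc n′) → ℕ
    index u = toℕ (Inverse.from label u)
    vertex-index : ∀ u → vertex (index u) ≡ u
    vertex-index u = trans (cong (Inverse.to label) (position-toℕ _)) (Inverse.strictlyInverseˡ label u)
    index-vertex : ∀ {i} → i < suc n′ → index (vertex i) ≡ i
    index-vertex i<n = trans (cong toℕ (Inverse.strictlyInverseʳ label _)) (toℕ-position i<n)
    no-edge : ∀ {u x} → index u < k → k ≤ index x → adj G u x ≡ false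
    no-edge {u} {x} u<k k≤x = begin
      adj G u x                                        ≡⟨ cong₂ (adj G) (sym (vertex-index u)) (sym (vertex-index x)) ⟩
      adj G (vertex (index u)) (vertex (index x))      ≡⟨ adjacent-forward (<-≤-trans u<k k≤x) (toℕ<n _) ⟩
      inverted (index u) (index x)                     ≡⟨ inverted-forward (<-≤-trans u<k k≤x) ⟩
      (relabel π (index x) <ᵇ relabel π (index u))     ≡⟨ <ᵇ-false (<⇒≤ (split u<k k≤x (toℕ<n _))) ⟩
      false ∎
    crossing : ∀ {u v} → Walk G u v → index u < k → k ≤ index v → ⊥
    crossing []                       u<k k≤u = <⇒≱ u<k k≤u
    crossing (_∷_ {w = x} edge rest) u<k k≤v with index x <? k
    ... | yes x<k = crossing rest x<k k≤v
    ... | no x≮k  = subst T (trans (sym edge) (no-edge u<k (≮⇒≥ x≮k))) _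
    first-side : index (vertex 0) < k
    first-side = subst (_< k) (sym (index-vertex z<s)) 0<k
    last-side : k ≤ index (vertex n′)
    last-side = subst (k ≤_) (sym (index-vertex ≤-refl)) (s≤s⁻¹ k<n)

  hamiltonianPath : HamiltonianSequence (suc n′) inverted → HasHamiltonianPath G
  hamiltonianPath sequence = label ↔-∘ order , adjacent
    where
    open HamiltonianSequence sequence
    open ≡-Reasoning
    visitFin : Fin (suc n′) → Fin (suc n′)
    visitFin t = position (visit (toℕ t))
    visitFin-injective : Injective _≡_ _≡_ visitFin
    visitFin-injective {s} {t} same = toℕ-injective (visit-injective (toℕ<n s) (toℕ<n t) (begin
      visit (toℕ s)       ≡⟨ sym (toℕ-position (visit-< (toℕ<n s))) ⟩
      toℕ (visitFin s)    ≡⟨ cong toℕ same ⟩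
      toℕ (visitFin t)    ≡⟨ toℕ-position (visit-< (toℕ<n t)) ⟩
      visit (toℕ t) ∎))
    order : Fin (suc n′) ↔ Fin (suc n′)
    order = injective⇒↔ visitFin-injective
    edge : ∀ {t} → suc t < suc n′ → Adj G (vertex (visit t)) (vertex (visit (suc t)))
    edge 1+t<n = trans (adjacent-inverted (visit-< (<-trans (n<1+n _) 1+t<n)) (visit-< 1+t<n))
                       (T⇒≡true (visit-adjacent 1+t<n))
    adjacent : ∀ i j → suc (toℕ i) ≡ toℕ j → Adj G (vertex (visit (toℕ i))) (vertex (visit (toℕ j)))
    adjacent i j next = subst (λ m → Adj G (vertex (visit (toℕ i))) (vertex (visit m))) next
                              (edge (subst (_< suc n′) (sym next) (toℕ<n j)))

corollary4p7 : ∀ (n : ℕ) (G : Graph n) → Connected G → Regular 3 G →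
    IsPermutationGraph G → HasHamiltonianPath G
corollary4p7 zero     G (() , _) _ _
corollary4p7 (suc n′) G connected regular (label , π , represents) =
  hamiltonianPath (CubicPermutation.hamiltonian perm cubic (indecomposable connected) z<s)
  where
  open PermutationGraph G label π represents
  open Inversions perm
  cubic : ∀ {i} → i < suc n′ → count (suc n′) (inverted i) ≡ 3
  cubic {i} i<n = trans (sym (degree-vertex i<n)) (regular (vertex i))
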